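{- Let $M$ be a binary matrix with rows $r_1,\dots,r_m$, and let $S_i=\{j : M_{ij}=1\}$. Suppose there are three distinct rows $r_a,r_b,r_c$ such that $S_a,S_b,S_c$ are pairwise intersecting and either (H1) $S_a\cap S_b\cap S_c=\emptyset$, or (H2) none of $S_a,S_b,S_c$ is contained in the union of the other two. Then every set $\mathcal{D}$ of rows of $M$ such that $M\setminus\mathcal{D}$ has the Consecutive Ones Property contains at least one of $r_a,r_b,r_c$.
   Context: A binary matrix has the Consecutive Ones Property (COP) if there is a permutation of its columns after which, in every row, the $1$-entries are consecutive. For a set $\mathcal{D}$ of rows, $M\setminus\mathcal{D}$ is the submatrix on the remaining rows. Sets are pairwise intersecting if every two have nonempty intersection. -}

module Defs where

open import Data.Nat using (ℕ)
open import Data.Bool using (Bool; true; false)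
open import Data.Fin using (Fin; _≤_)
open import Data.Fin.Permutation using (Permutation′; _⟨$⟩ʳ_)
open import Data.Fin.Subset using (Subset; _∈_; _∉_)
open import Data.Product using (Σ; ∃; _×_; _,_)
open import Data.Sum using (_⊎_)
open import Data.Empty using (⊥)
open import Relation.Nullary using (¬_)
open import Relation.Binary.PropositionalEquality using (_≡_)

BinMatrix : ℕ → ℕ → Set
BinMatrix m n = Fin m → Fin n → Bool


-- A row (a Bool-valued function on columns) has consecutive ones
-- w.r.t. a column ordering σ (σ maps positions to columns):
-- whenever positions p ≤ q ≤ r and the entries at p and r are 1, so is the one at q.
ConsecutiveUnder : ∀ {n} → Permutation′ n → (Fin n → Bool) → Set
ConsecutiveUnder {n} σ row =
  ∀ (p q r : Fin n) → p ≤ q → q ≤ r →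
    row (σ ⟨$⟩ʳ p) ≡ true → row (σ ⟨$⟩ʳ r) ≡ true → row (σ ⟨$⟩ʳ q) ≡ true

COPWithout : ∀ {m n} → BinMatrix m n → Subset m → Set
COPWithout {m} {n} M D =
  ∃ λ (σ : Permutation′ n) → ∀ (i : Fin m) → i ∉ D → ConsecutiveUnder σ (M i)

Intersect : ∀ {m n} → BinMatrix m n → Fin m → Fin m → Set
Intersect {n = n} M a b = ∃ λ (j : Fin n) → (M a j ≡ true) × (M b j ≡ true)

PairwiseIntersecting : ∀ {m n} → BinMatrix m n → Fin m → Fin m → Fin m → Set
PairwiseIntersecting M a b c = Intersect M a b × Intersect M a c × Intersect M b c

TripleEmpty : ∀ {m n} → BinMatrix m n → Fin m → Fin m → Fin m → Set
TripleEmpty {n = n} M a b c =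
  ∀ (j : Fin n) → M a j ≡ true → M b j ≡ true → M c j ≡ true → ⊥

SubsetOfUnion : ∀ {m n} → BinMatrix m n → Fin m → Fin m → Fin m → Set
SubsetOfUnion {n = n} M a b c =
  ∀ (j : Fin n) → M a j ≡ true → (M b j ≡ true) ⊎ (M c j ≡ true)

NoneInUnionOfOthers : ∀ {m n} → BinMatrix m n → Fin m → Fin m → Fin m → Set
NoneInUnionOfOthers M a b c =
  ¬ SubsetOfUnion M a b c × ¬ SubsetOfUnion M b a c × ¬ SubsetOfUnion M c a b

module Submission where

-- Fix an ordering σ of the columns witnessing the COP of M \ D
-- and suppose none of the rows a, b, c lies in D.  Read in the order σ,
-- each of the three rows is then an interval of positions, and both
-- hypotheses are impossible for three pairwise-intersecting intervals:
--
--  * (H1) fails by the one-dimensional Helly property: pairwise-intersecting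
--    intervals have a common point (pick a point in each pairwise
--    intersection; the middle one of these three points lies in all three).
--  * (H2) fails because three pairwise-intersecting intervals cannot each
--    own a private point: the middle private point separates the other two
--    intervals, which would then be disjoint.

open import Defs
open import Data.Nat using (ℕ)
open import Data.Fin using (Fin)
open import Data.Fin.Subset using (Subset; _∈_)
open import Data.Product using (_×_)
open import Data.Sum using (_⊎_)
open import Relation.Nullary using (¬_)
open import Relation.Binary.PropositionalEquality using (_≡_)

open import Level using (Level; _⊔_)
open import Data.Fin using () renaming (_≤_ to _≤ᶠ_)
open import Data.Bool using (true)
import Data.Bool.Properties as Bool
open import Data.Fin.Permutation using (Permutation′; _⟨$⟩ʳ_; _⟨$⟩ˡ_; inverseʳ)
open import Data.Fin.Subset.Properties using (_∈?_)
open import Data.Fin.Properties using (¬∀⟶∃¬) renaming (≤-total to ≤-total-Fin)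
open import Data.Product using (∃; _,_)
open import Data.Sum using (inj₁; inj₂)
open import Data.Empty using (⊥; ⊥-elim)
open import Relation.Nullary using (Dec; yes; no)
open import Relation.Nullary.Decidable using (_→-dec_; _⊎-dec_)
open import Relation.Binary.Core using (Rel)
open import Relation.Binary.Definitions using (Total)
open import Relation.Binary.PropositionalEquality using (cong; subst; sym)

refute-implication : ∀ {A B C : Set} → Dec A → ¬ (A → B ⊎ C) → A × ¬ B × ¬ C
refute-implication (no ¬a) ¬imp = ⊥-elim (¬imp (λ a → ⊥-elim (¬a a)))
refute-implication (yes a) ¬imp =
  a , (λ b → ¬imp (λ _ → inj₁ b)) , (λ c → ¬imp (λ _ → inj₂ c))

module Intervals {a ℓ : Level} {A : Set a} (_≤_ : Rel A ℓ) (total : Total _≤_) where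

  Convex : (A → Set) → Set (a ⊔ ℓ)
  Convex P = ∀ p q r → p ≤ q → q ≤ r → P p → P r → P q

  Between : A → A → A → Set ℓ
  Between q p r = (p ≤ q × q ≤ r) ⊎ (r ≤ q × q ≤ p)

  middle-of-three : ∀ x y z → Between x y z ⊎ Between y x z ⊎ Between z x y
  middle-of-three x y z with total x y | total y z | total x z
  ... | inj₁ x≤y | inj₁ y≤z | _       = inj₂ (inj₁ (inj₁ (x≤y , y≤z)))
  ... | inj₁ x≤y | inj₂ z≤y | inj₁ x≤z = inj₂ (inj₂ (inj₁ (x≤z , z≤y)))
  ... | inj₁ x≤y | inj₂ z≤y | inj₂ z≤x = inj₁ (inj₂ (z≤x , x≤y))
  ... | inj₂ y≤x | inj₁ y≤z | inj₁ x≤z = inj₁ (inj₁ (y≤x , x≤z))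
  ... | inj₂ y≤x | inj₁ y≤z | inj₂ z≤x = inj₂ (inj₂ (inj₂ (y≤z , z≤x)))
  ... | inj₂ y≤x | inj₂ z≤y | _       = inj₂ (inj₁ (inj₂ (z≤y , y≤x)))

  convex-between : ∀ {P} → Convex P → ∀ {q p r} → Between q p r → P p → P r → P q
  convex-between conv {q} {p} {r} (inj₁ (p≤q , q≤r)) Pp Pr = conv p q r p≤q q≤r Pp Pr
  convex-between conv {q} {p} {r} (inj₂ (r≤q , q≤p)) Pp Pr = conv r q p r≤q q≤p Pr Pp

  helly : ∀ {P Q R} → Convex P → Convex Q → Convex R → ∀ {x y z} →
          P x → Q x → P y → R y → Q z → R z → ∃ λ w → P w × Q w × R w
  helly {P} {Q} {R} cP cQ cR {x} {y} {z} Px Qx Py Ry Qz Rz with middle-of-three x y z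
  ... | inj₁ x-mid        = x , Px , Qx , convex-between cR x-mid Ry Rz
  ... | inj₂ (inj₁ y-mid) = y , Py , convex-between cQ y-mid Qx Qz , Ry
  ... | inj₂ (inj₂ z-mid) = z , convex-between cP z-mid Px Py , Qz , Rz

  separated-disjoint : ∀ {P Q} → Convex P → Convex Q → ∀ {q u v} →
                       Between q u v → P u → Q v → ¬ P q → ¬ Q q →
                       ¬ (∃ λ w → P w × Q w)
  separated-disjoint cP cQ {q} {u} {v} q-mid Pu Qv ¬Pq ¬Qq (w , Pw , Qw)
    with total w q | q-mid
  ... | inj₁ w≤q | inj₁ (_ , q≤v) = ¬Qq (cQ w q v w≤q q≤v Qw Qv)
  ... | inj₁ w≤q | inj₂ (_ , q≤u) = ¬Pq (cP w q u w≤q q≤u Pw Pu)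
  ... | inj₂ q≤w | inj₁ (u≤q , _) = ¬Pq (cP u q w u≤q q≤w Pu Pw)
  ... | inj₂ q≤w | inj₂ (v≤q , _) = ¬Qq (cQ v q w v≤q q≤w Qv Qw)

  no-three-private-points :
    ∀ {P Q R} → Convex P → Convex Q → Convex R →
    (∃ λ w → P w × Q w) → (∃ λ w → P w × R w) → (∃ λ w → Q w × R w) →
    ∀ {x y z} → P x × ¬ Q x × ¬ R x → Q y × ¬ P y × ¬ R y → R z × ¬ P z × ¬ Q z → ⊥
  no-three-private-points cP cQ cR PQ PR QR
    {x} {y} {z} (Px , ¬Qx , ¬Rx) (Qy , ¬Py , ¬Ry) (Rz , ¬Pz , ¬Qz)
    with middle-of-three x y z
  ... | inj₁ x-mid        = separated-disjoint cQ cR x-mid Qy Rz ¬Qx ¬Rx QR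
  ... | inj₂ (inj₁ y-mid) = separated-disjoint cP cR y-mid Px Rz ¬Py ¬Ry PR
  ... | inj₂ (inj₂ z-mid) = separated-disjoint cP cQ z-mid Px Qy ¬Pz ¬Qz PQ

module RowsAlong {m n : ℕ} (M : BinMatrix m n) (σ : Permutation′ n) where

  open Intervals (_≤ᶠ_ {n}) ≤-total-Fin public

  -- The positions (w.r.t. σ) holding a one in row i.  By definition,
  -- ConsecutiveUnder σ (M i) is literally Convex (Ones i).
  Ones : Fin m → Fin n → Set
  Ones i p = M i (σ ⟨$⟩ʳ p) ≡ true

  entry-at-position : ∀ i j → M i (σ ⟨$⟩ʳ (σ ⟨$⟩ˡ j)) ≡ M i j
  entry-at-position i j = cong (M i) (inverseʳ σ)

  to-position : ∀ {i j} → M i j ≡ true → Ones i (σ ⟨$⟩ˡ j)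
  to-position {i} {j} = subst (_≡ true) (sym (entry-at-position i j))

  not-to-position : ∀ {i j} → ¬ M i j ≡ true → ¬ Ones i (σ ⟨$⟩ˡ j)
  not-to-position {i} {j} ¬Mij Pij = ¬Mij (subst (_≡ true) (entry-at-position i j) Pij)

  intersect-positions : ∀ {i k} → Intersect M i k → ∃ λ p → Ones i p × Ones k p
  intersect-positions (j , Mij , Mkj) = σ ⟨$⟩ˡ j , to-position Mij , to-position Mkj

  -- If S_i ⊄ S_k ∪ S_l, some position is a one of row i only
  -- (classical witness extraction, valid since Fin n is finite and entries decidable).
  private-position : ∀ {i k l} → ¬ SubsetOfUnion M i k l →
                     ∃ λ p → Ones i p × ¬ Ones k p × ¬ Ones l p
  private-position {i} {k} {l} ¬sub
    with ¬∀⟶∃¬ n _ (λ j → (M i j Bool.≟ true) →-dec ((M k j Bool.≟ true) ⊎-dec (M l j Bool.≟ true))) ¬sub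
  ... | j , ¬covered with refute-implication (M i j Bool.≟ true) ¬covered
  ...   | Mij , ¬Mkj , ¬Mlj = σ ⟨$⟩ˡ j , to-position Mij , not-to-position ¬Mkj , not-to-position ¬Mlj

  incompatible : ∀ {a b c} → Convex (Ones a) → Convex (Ones b) → Convex (Ones c) →
                 PairwiseIntersecting M a b c →
                 TripleEmpty M a b c ⊎ NoneInUnionOfOthers M a b c → ⊥
  incompatible ca cb cc (ab , ac , bc) (inj₁ triple-empty)
    with intersect-positions ab | intersect-positions ac | intersect-positions bc
  ... | _ , Pa₁ , Pb₁ | _ , Pa₂ , Pc₂ | _ , Pb₃ , Pc₃
    with helly ca cb cc Pa₁ Pb₁ Pa₂ Pc₂ Pb₃ Pc₃
  ...   | p , Pa , Pb , Pc = triple-empty (σ ⟨$⟩ʳ p) Pa Pb Pc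
  incompatible ca cb cc (ab , ac , bc) (inj₂ (¬a⊆bc , ¬b⊆ac , ¬c⊆ab))
    with private-position ¬a⊆bc | private-position ¬b⊆ac | private-position ¬c⊆ab
  ... | _ , (Pa , ¬Pb , ¬Pc) | _ , (Qb , ¬Qa , ¬Qc) | _ , (Rc , ¬Ra , ¬Rb) =
    no-three-private-points ca cb cc
      (intersect-positions ab) (intersect-positions ac) (intersect-positions bc)
      (Pa , ¬Pb , ¬Pc) (Qb , ¬Qa , ¬Qc) (Rc , ¬Ra , ¬Rb)

lemma3 : ∀ {m n : ℕ} (M : BinMatrix m n) (a b c : Fin m) →
    ¬ a ≡ b → ¬ a ≡ c → ¬ b ≡ c →
    PairwiseIntersecting M a b c →
    TripleEmpty M a b c ⊎ NoneInUnionOfOthers M a b c →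
    ∀ (D : Subset m) → COPWithout M D →
    (a ∈ D) ⊎ (b ∈ D) ⊎ (c ∈ D)
lemma3 M a b c _ _ _ pairwise hyp D (σ , consecutive) with a ∈? D | b ∈? D | c ∈? D
... | yes a∈D | _       | _       = inj₁ a∈D
... | no _    | yes b∈D | _       = inj₂ (inj₁ b∈D)
... | no _    | no _    | yes c∈D = inj₂ (inj₂ c∈D)
... | no a∉D  | no b∉D  | no c∉D  =
  ⊥-elim (RowsAlong.incompatible M σ
            (consecutive a a∉D) (consecutive b b∉D) (consecutive c c∉D) pairwise hyp)
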